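{- Let $m,n\ge 3$ be integers and let $C_m\boxtimes C_n$ denote the strong product of the cycles $C_m$ and $C_n$. Then $C_m\boxtimes C_n$ is closed distance magic if and only if at least one of the following holds: (1) $m\equiv 3 \pmod 6$ and $n\equiv 3\pmod 6$; (2) $\{m,n\}=\{3,x\}$ for some odd integer $x$.
   Context: All graphs are finite and simple. For a vertex $x$ of a graph $G$, $N[x]$ is its closed neighborhood ($x$ together with all its neighbors). A graph $G$ on $n$ vertices is closed distance magic if there is a bijection $\ell\colon V(G)\to\{1,\dots,n\}$ and a positive integer $k'$ such that $\sum_{y\in N[x]}\ell(y)=k'$ for every $x\in V(G)$. The strong product $G\boxtimes H$ has vertex set $V(G)\times V(H)$, and $(g,h)$, $(g',h')$ are adjacent iff either $g=g'$ and $hh'\in E(H)$, or $h=h'$ and $gg'\in E(G)$, or $gg'\in E(G)$ and $hh'\in E(H)$. $C_k$ denotes the cycle on $k$ vertices. -}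

module Defs where

open import Data.Nat using (ℕ; zero; suc; _+_; _*_; _≥_; _%_)
import Data.Nat as ℕ
open import Data.Nat.ListAction using (sum)
open import Data.Fin using (Fin; toℕ)
open import Data.Fin.Properties using (_≟_; *↔×)
open import Data.Bool using (Bool; true; false; _∧_; _∨_; if_then_else_)
open import Data.Product using (_×_; _,_; Σ)
open import Data.List using (List; map; allFin)
open import Relation.Binary.PropositionalEquality using (_≡_)
open import Relation.Nullary.Decidable using (⌊_⌋)
open import Function.Bundles using (_↔_; Inverse)

-- A finite graph: a vertex type with a fixed enumeration Fin size ↔ V
-- (so |V| = size) and a Boolean adjacency relation.  (The concrete graphs used
-- below, cycles and their strong products, are simple: adjacency is symmetric
-- and irreflexive.)
record Graph : Set₁ where
  field
    V    : Set
    size : ℕ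
    enum : Fin size ↔ V
    adj  : V → V → Bool

open Graph public

vertices : (G : Graph) → List (V G)
vertices G = map (Inverse.to (enum G)) (allFin (size G))

closedAdj : (G : Graph) → V G → V G → Bool
closedAdj G x y = adj G x y ∨ ⌊ Inverse.from (enum G) x ≟ Inverse.from (enum G) y ⌋

closedNbhdSum : (G : Graph) → (V G → ℕ) → V G → ℕ
closedNbhdSum G f x = sum (map (λ y → if closedAdj G x y then f y else 0) (vertices G))

-- closed distance magic: a bijection ℓ : V(G) → {1,…,n}, encoded as
-- V(G) ↔ Fin n with label toℕ(ℓ y) + 1, and a positive integer k' such that
-- Σ_{y ∈ N[x]} ℓ(y) = k' for every vertex x.
ClosedDistanceMagic : Graph → Set
ClosedDistanceMagic G =
  Σ (V G ↔ Fin (size G)) λ ℓ → Σ ℕ λ k' → (k' ≥ 1 ×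
    (∀ (x : V G) → closedNbhdSum G (λ y → suc (toℕ (Inverse.to ℓ y))) x ≡ k'))

cycAdj : (k : ℕ) → Fin k → Fin k → Bool
cycAdj zero    i j = false
cycAdj (suc k) i j = ⌊ toℕ j ℕ.≟ suc (toℕ i) % suc k ⌋ ∨ ⌊ toℕ i ℕ.≟ suc (toℕ j) % suc k ⌋

-- the cycle C_k (intended for k ≥ 3)
Cycle : ℕ → Graph
Cycle k = record { V = Fin k ; size = k ; enum = Function.Bundles.mk↔ₛ′ (λ i → i) (λ i → i) (λ _ → Relation.Binary.PropositionalEquality.refl) (λ _ → Relation.Binary.PropositionalEquality.refl) ; adj = cycAdj k }
  where import Function.Bundles
        import Relation.Binary.PropositionalEquality

_⊠_ : Graph → Graph → Graph
G ⊠ H = record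
  { V    = V G × V H
  ; size = size G * size H
  ; enum = Function.Construct.Composition.inverse *↔× (Data.Product.Function.NonDependent.Propositional._×-↔_ (enum G) (enum H))
  ; adj  = λ { (g , h) (g' , h') →
              (eqG g g' ∧ adj H h h') ∨ (eqH h h' ∧ adj G g g') ∨ (adj G g g' ∧ adj H h h') }
  }
  where
  import Function.Construct.Composition
  import Data.Product.Function.NonDependent.Propositional
  eqG : V G → V G → Bool
  eqG a b = ⌊ Inverse.from (enum G) a ≟ Inverse.from (enum G) b ⌋
  eqH : V H → V H → Bool
  eqH a b = ⌊ Inverse.from (enum H) a ≟ Inverse.from (enum H) b ⌋

-- Closed neighbourhoods of C_m ⊠ C_n are the 3 × 3 windows of the m × n torus, so a closed
-- distance magic labelling is a bijection φ from the torus onto {0, …, mn − 1} (labels lowered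
-- by one) all of whose window sums equal some k.
-- If 3 ∤ m, the row triples r_b(a) = φ(a,b) + φ(a,b+1) + φ(a,b+2) satisfy
-- r_b(a) + r_b(a+1) + r_b(a+2) = k, so they are 3-periodic as well as m-periodic in a, hence
-- constant, and 3 r_b = k for every b. Then every row of φ is 3-periodic, injectivity forces
-- n = 3, and summing all labels gives 2c + 3 = 9m for c = k/3, so m is odd.
-- If m = 3s and n = 3t, tiling the torus by st windows gives st·k = mn(mn − 1)/2, that is
-- 2k + 9 = 81st, so s and t are odd.
-- Conversely, three permutations of {0, …, 2h} adding up to 3h at every point serve as digits
-- of a labelling for m = 3(2g + 1) and n = 2h + 1 whenever 3 ∣ n or g = 0; transposing it
-- covers m odd, n = 3.

module Submission where

open import Defs
open import Data.Bool using (Bool; true; false; _∧_; _∨_; if_then_else_)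
open import Data.Bool.Properties using (∨-zeroʳ)
open import Data.Fin using (Fin; zero; suc; toℕ; fromℕ<; combine; remQuot; _↑ˡ_; _↑ʳ_; punchOut)
open import Data.Fin.Properties
  using (_≟_; toℕ-fromℕ<; toℕ-injective; toℕ<n; remQuot-combine; combine-injective; *↔×;
         any?; punchOut-injective; injective⇒≤)
open import Data.List using (map; allFin; tabulate)
open import Data.List.Properties using (map-tabulate; map-∘)
import Data.Nat.ListAction as List
open import Data.Nat
  using (ℕ; zero; suc; _+_; _*_; _∸_; _<_; _≤_; _≥_; _<?_; _%_; _/_; z≤n; s≤s; s≤s⁻¹;
         NonZero; >-nonZero)
import Data.Nat as ℕ
open import Data.Nat.DivMod
open import Data.Nat.Divisibility using (_∣_; divides)
open import Data.Nat.Properties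
  using (+-0-commutativeMonoid; +-assoc; +-comm; +-suc; +-identityʳ; +-cancelˡ-≡; +-cancelʳ-≡;
         *-comm; *-assoc; *-distribʳ-+; *-cancelˡ-≡; *-cancelʳ-≡; m*n≢0; suc-injective;
         ≤-reflexive; ≤-trans; <-irrefl; ≤∧≢⇒<; <⇒≢; <⇒≱; ≮⇒≥; m≤m+n; m≤n+m;
         +-cancelˡ-≤;
         +-monoˡ-≤; *-monoˡ-≤; m+[n∸m]≡n; [m+n]∸[m+o]≡n∸o; m+n∸m≡n)
open import Data.Nat.Tactic.RingSolver using (solve-∀)
open import Data.Product using (Σ; _×_; _,_; proj₁; proj₂; ∃; ∃₂; swap)
open import Data.Product.Properties using (,-injective)
open import Data.Sum using (_⊎_; inj₁; inj₂)
open import Function using (_∘_; id)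
open import Function.Bundles using (Inverse; Injection; _↔_; mk↔ₛ′; _⇔_; mk⇔)
open import Function.Definitions using (Injective)
open import Function.Properties.Inverse using (↔-sym; ↔-trans; ↔⇒↣)
open import Relation.Nullary using (¬_; contradiction)
open import Relation.Nullary.Decidable
  using (Dec; ⌊_⌋; yes; no; does; isYes≗does; does-⇔; dec-true; dec-false; _×-dec_)
open import Relation.Binary.PropositionalEquality
open import Algebra.Properties.CommutativeMonoid.Sum +-0-commutativeMonoid
  using (sum-syntax; sum-cong-≗; sum-replicate-zero; ∑-distrib-+; sum-permute)

∑-splitAt : ∀ a b (f : Fin (a + b) → ℕ) →
  ∑[ k < a + b ] f k ≡ ∑[ i < a ] f (i ↑ˡ b) + ∑[ j < b ] f (a ↑ʳ j)
∑-splitAt zero    b f = refl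
∑-splitAt (suc a) b f =
  trans (cong (f zero +_) (∑-splitAt a b (f ∘ suc))) (sym (+-assoc (f zero) _ _))

∑-combine : ∀ m n (f : Fin (m * n) → ℕ) →
  ∑[ k < m * n ] f k ≡ ∑[ i < m ] ∑[ j < n ] f (combine i j)
∑-combine zero    n f = refl
∑-combine (suc m) n f =
  trans (∑-splitAt n (m * n) f) (cong (∑[ j < n ] f (j ↑ˡ (m * n)) +_) (∑-combine m n (f ∘ (n ↑ʳ_))))

∑-remQuot : ∀ m n (h : Fin m × Fin n → ℕ) →
  ∑[ k < m * n ] h (remQuot n k) ≡ ∑[ i < m ] ∑[ j < n ] h (i , j)
∑-remQuot m n h = trans (∑-combine m n (h ∘ remQuot n))
  (sum-cong-≗ λ i → sum-cong-≗ λ j → cong h (remQuot-combine i j))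

sum-map-allFin : ∀ n (f : Fin n → ℕ) → List.sum (map f (allFin n)) ≡ ∑[ i < n ] f i
sum-map-allFin n f = trans (cong List.sum (map-tabulate id f)) (sum-tabulate n f)
  where
  sum-tabulate : ∀ n (f : Fin n → ℕ) → List.sum (tabulate f) ≡ ∑[ i < n ] f i
  sum-tabulate zero    f = refl
  sum-tabulate (suc n) f = cong (f zero +_) (sum-tabulate n (f ∘ suc))

∑-indicator : ∀ {N} (x : Fin N) (g : Fin N → ℕ) → ∑[ j < N ] (if does (j ≟ x) then g j else 0) ≡ g x
∑-indicator {suc N} zero    g = trans (cong (g zero +_) (sum-replicate-zero N)) (+-identityʳ (g zero))
∑-indicator {suc N} (suc x) g = ∑-indicator x (g ∘ suc)

∑-if-three : ∀ {N} (P : Fin N → Bool) (g : Fin N → ℕ) {u v w} →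
  u ≢ v → u ≢ w → v ≢ w → P u ≡ true → P v ≡ true → P w ≡ true →
  (∀ j → P j ≡ true → j ≡ u ⊎ j ≡ v ⊎ j ≡ w) →
  ∑[ j < N ] (if P j then g j else 0) ≡ g u + g v + g w
∑-if-three {N} P g {u} {v} {w} u≢v u≢w v≢w Pu Pv Pw P⇒∈ = begin
  ∑[ j < N ] (if P j then g j else 0)      ≡⟨ sum-cong-≗ split ⟩
  ∑[ j < N ] (δ u j + δ v j + δ w j)       ≡⟨ ∑-distrib-+ (λ j → δ u j + δ v j) (δ w) ⟩
  ∑[ j < N ] (δ u j + δ v j) + ∑[ j < N ] δ w j
    ≡⟨ cong (_+ ∑[ j < N ] δ w j) (∑-distrib-+ (δ u) (δ v)) ⟩
  ∑[ j < N ] δ u j + ∑[ j < N ] δ v j + ∑[ j < N ] δ w j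
    ≡⟨ cong₂ _+_ (cong₂ _+_ (∑-indicator u g) (∑-indicator v g)) (∑-indicator w g) ⟩
  g u + g v + g w                           ∎
  where
  open ≡-Reasoning
  δ : Fin N → Fin N → ℕ
  δ x j = if does (j ≟ x) then g j else 0
  δ-self : ∀ x → δ x x ≡ g x
  δ-self x = cong (λ b → if b then g x else 0) (dec-true (x ≟ x) refl)
  δ-≢ : ∀ {x j} → j ≢ x → δ x j ≡ 0
  δ-≢ {x} {j} j≢x = cong (λ b → if b then g j else 0) (dec-false (j ≟ x) j≢x)
  split : ∀ j → (if P j then g j else 0) ≡ δ u j + δ v j + δ w j
  split j with P j in Pj≡
  ... | false = sym (cong₂ _+_ (cong₂ _+_ (δ-≢ (excluded Pu)) (δ-≢ (excluded Pv))) (δ-≢ (excluded Pw)))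
    where
    excluded : ∀ {x} → P x ≡ true → j ≢ x
    excluded Px refl with () ← trans (sym Pj≡) Px
  ... | true with P⇒∈ j Pj≡
  ... | inj₁ refl        = sym (trans (cong₂ _+_ (cong₂ _+_ (δ-self u) (δ-≢ u≢v)) (δ-≢ u≢w))
                                      (trans (+-identityʳ (g u + 0)) (+-identityʳ (g u))))
  ... | inj₂ (inj₁ refl) = sym (trans (cong₂ _+_ (cong₂ _+_ (δ-≢ (u≢v ∘ sym)) (δ-self v)) (δ-≢ v≢w))
                                      (+-identityʳ (g v)))
  ... | inj₂ (inj₂ refl) =
    sym (cong₂ _+_ (cong₂ _+_ (δ-≢ (u≢w ∘ sym)) (δ-≢ (v≢w ∘ sym))) (δ-self w))

∑ℕ : ℕ → (ℕ → ℕ) → ℕ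
∑ℕ n f = ∑[ i < n ] f (toℕ i)

∑ℕ-cong : ∀ n {f g} → (∀ x → f x ≡ g x) → ∑ℕ n f ≡ ∑ℕ n g
∑ℕ-cong n f≗g = sum-cong-≗ {n} (f≗g ∘ toℕ)

∑ℕ-const : ∀ n c → ∑ℕ n (λ _ → c) ≡ n * c
∑ℕ-const zero    c = refl
∑ℕ-const (suc n) c = cong (c +_) (∑ℕ-const n c)

∑ℕ-id : ∀ N → 2 * ∑ℕ N id + N ≡ N * N
∑ℕ-id zero    = refl
∑ℕ-id (suc N) = begin
  2 * ∑ℕ N suc + suc N
    ≡⟨ cong (λ S → 2 * S + suc N) (∑-distrib-+ (λ _ → 1) (toℕ {N})) ⟩
  2 * (∑ℕ N (λ _ → 1) + ∑ℕ N id) + suc N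
    ≡⟨ cong (λ c → 2 * (c + ∑ℕ N id) + suc N) (∑ℕ-const N 1) ⟩
  2 * (N * 1 + ∑ℕ N id) + suc N          ≡⟨ regroup N (∑ℕ N id) ⟩
  (2 * ∑ℕ N id + N) + suc (N + N)        ≡⟨ cong (_+ suc (N + N)) (∑ℕ-id N) ⟩
  N * N + suc (N + N)                    ≡⟨ square-suc N ⟩
  suc N * suc N                          ∎
  where
  open ≡-Reasoning
  regroup : ∀ N S → 2 * (N * 1 + S) + suc N ≡ (2 * S + N) + suc (N + N)
  regroup = solve-∀
  square-suc : ∀ N → N * N + suc (N + N) ≡ suc N * suc N
  square-suc = solve-∀

Fin-injective⇒surjective : ∀ {N} (f : Fin N → Fin N) → Injective _≡_ _≡_ f →
  ∀ y → ∃ λ x → f x ≡ y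
Fin-injective⇒surjective {suc N} f f-inj y with any? (λ x → f x ≟ y)
... | yes hit = hit
... | no miss = contradiction (injective⇒≤ g-inj) (<-irrefl refl)
  where
  y≢f : ∀ x → y ≢ f x
  y≢f x y≡fx = miss (x , sym y≡fx)
  g : Fin (suc N) → Fin N
  g x = punchOut (y≢f x)
  g-inj : Injective _≡_ _≡_ g
  g-inj {x} {x'} e = f-inj (punchOut-injective (y≢f x) (y≢f x') e)

injection⇒↔ : ∀ {A : Set} {N} → A ↔ Fin N → (f : A → Fin N) → Injective _≡_ _≡_ f → A ↔ Fin N
injection⇒↔ e f f-inj =
  mk↔ₛ′ f from (λ y → proj₂ (preimage y)) (λ a → f-inj (proj₂ (preimage (f a))))
  where
  preimage : ∀ y → ∃ λ a → f a ≡ y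
  preimage y with x , fx≡y ← Fin-injective⇒surjective (f ∘ Inverse.from e)
                               (Injection.injective (↔⇒↣ (↔-sym e)) ∘ f-inj) y
    = Inverse.from e x , fx≡y
  from = λ y → proj₁ (preimage y)

[n+m]%n≡m%n : ∀ n m .{{_ : NonZero n}} → (n + m) % n ≡ m % n
[n+m]%n≡m%n n m = trans (cong (_% n) (+-comm n m)) ([m+n]%n≡m%n m n)

m%n≡r⇒m≡r+[m/n]*n : ∀ {m n r} .{{_ : NonZero n}} → m % n ≡ r → m ≡ r + m / n * n
m%n≡r⇒m≡r+[m/n]*n {m} {n} m%n≡r = trans (m≡m%n+[m/n]*n m n) (cong (_+ m / n * n) m%n≡r)

%-absorbʳ : ∀ m n d .{{_ : NonZero d}} → (m + n % d) % d ≡ (m + n) % d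
%-absorbʳ m n d = begin
  (m + n % d) % d          ≡⟨ %-distribˡ-+ m (n % d) d ⟩
  (m % d + n % d % d) % d  ≡⟨ cong (λ r → (m % d + r) % d) (m%n%n≡m%n n d) ⟩
  (m % d + n % d) % d      ≡⟨ %-distribˡ-+ m n d ⟨
  (m + n) % d              ∎
  where open ≡-Reasoning

-- The predecessor of r modulo 1 + d is (d + r) % (1 + d).
suc-%-injective : ∀ {d x y} → x < suc d → y < suc d → suc x % suc d ≡ suc y % suc d → x ≡ y
suc-%-injective {d} {x} {y} x<1+d y<1+d e =
  trans (sym (pred-suc-% x<1+d)) (trans (cong (λ r → (d + r) % suc d) e) (pred-suc-% y<1+d))
  where
  pred-suc-% : ∀ {x} → x < suc d → (d + suc x % suc d) % suc d ≡ x
  pred-suc-% {x} x<1+d = begin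
    (d + suc x % suc d) % suc d  ≡⟨ %-absorbʳ d (suc x) (suc d) ⟩
    (d + suc x) % suc d          ≡⟨ cong (_% suc d) (trans (+-suc d x) (+-comm (suc d) x)) ⟩
    (x + suc d) % suc d          ≡⟨ [m+n]%n≡m%n x (suc d) ⟩
    x % suc d                    ≡⟨ m<n⇒m%n≡m x<1+d ⟩
    x                            ∎
    where open ≡-Reasoning

%-shift-≢ : ∀ {d s z} .{{_ : NonZero d}} → 0 < s → s < d → z < d → (s + z) % d ≢ z
%-shift-≢ {d} {s} {z} 0<s s<d z<d e = <⇒≢ 0<s (sym s≡0)
  where
  q = (s + z) / d
  s≡q*d : s ≡ q * d
  s≡q*d = +-cancelʳ-≡ z s (q * d) (trans (m%n≡r⇒m≡r+[m/n]*n e) (+-comm z (q * d)))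
  s≡0 : s ≡ 0
  s≡0 = trans (sym (m<n⇒m%n≡m s<d)) (trans (cong (_% d) s≡q*d) (m*n%n≡0 q d))

toℕ-mod : ∀ a d .{{_ : NonZero d}} → toℕ (a mod d) ≡ a % d
toℕ-mod a d = toℕ-fromℕ< (m%n<n a d)

mod-shift-≢ : ∀ {d s} .{{_ : NonZero d}} → 0 < s → s < d → ∀ a → a mod d ≢ (s + a) mod d
mod-shift-≢ {d} {s} 0<s s<d a e = %-shift-≢ 0<s s<d (m%n<n a d) (begin
  (s + a % d) % d  ≡⟨ %-absorbʳ s a d ⟩
  (s + a) % d      ≡⟨ toℕ-mod (s + a) d ⟨
  toℕ ((s + a) mod d) ≡⟨ cong toℕ e ⟨
  toℕ (a mod d)    ≡⟨ toℕ-mod a d ⟩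
  a % d            ∎)
  where open ≡-Reasoning

mod-injective : ∀ {d a a'} .{{_ : NonZero d}} → a < d → a' < d → a mod d ≡ a' mod d → a ≡ a'
mod-injective {d} {a} {a'} a<d a'<d e =
  trans (sym (m<n⇒m%n≡m a<d)) (trans (sym (toℕ-mod a d))
    (trans (cong toℕ e) (trans (toℕ-mod a' d) (m<n⇒m%n≡m a'<d))))

mod-periodic : ∀ d .{{_ : NonZero d}} x → (d + x) mod d ≡ x mod d
mod-periodic d x = toℕ-injective (trans (toℕ-mod (d + x) d) (trans ([n+m]%n≡m%n d x) (sym (toℕ-mod x d))))

suc-mod-surjective : ∀ {d} (x : Fin (suc d)) → suc (toℕ x + d) mod suc d ≡ x
suc-mod-surjective {d} x = toℕ-injective (begin
  toℕ (suc (toℕ x + d) mod suc d)  ≡⟨ toℕ-mod (suc (toℕ x + d)) (suc d) ⟩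
  suc (toℕ x + d) % suc d          ≡⟨ cong (_% suc d) (sym (+-suc (toℕ x) d)) ⟩
  (toℕ x + suc d) % suc d          ≡⟨ [m+n]%n≡m%n (toℕ x) (suc d) ⟩
  toℕ x % suc d                    ≡⟨ m<n⇒m%n≡m (toℕ<n x) ⟩
  toℕ x                            ∎)
  where open ≡-Reasoning

odd-*-%2 : ∀ q x → (suc (q * 2) * x) % 2 ≡ x % 2
odd-*-%2 q x = trans (cong (_% 2) (expand q x)) ([m+kn]%n≡m%n x (q * x) 2)
  where
  expand : ∀ q x → suc (q * 2) * x ≡ x + q * x * 2
  expand = solve-∀

%2≡1-*ˡ : ∀ s t → (s * t) % 2 ≡ 1 → s % 2 ≡ 1
%2≡1-*ˡ s t st%2≡1 with s % 2 | m%n<n s 2 | %-distribˡ-* s t 2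
... | 1 | _ | _ = refl
... | 0 | _ | st%2≡0 = contradiction (trans (sym st%2≡0) st%2≡1) λ ()
... | suc (suc _) | s≤s (s≤s ()) | _

odd-*3-%6 : ∀ s → s % 2 ≡ 1 → (s * 3) % 6 ≡ 3
odd-*3-%6 s s%2≡1 = trans (sym (m%n*o≡m*o%[n*o] s 2 3)) (cong (_* 3) s%2≡1)

*2≢1+*2 : ∀ x y → x * 2 ≢ suc (y * 2)
*2≢1+*2 x y e =
  contradiction (trans (sym ([m+kn]%n≡m%n 0 x 2)) (trans (cong (_% 2) e) ([m+kn]%n≡m%n 1 y 2))) λ ()

≤-offset : ∀ {a b} c → a + c ≡ b → a ≤ b
≤-offset {a} c refl = m≤m+n a c

+-*-< : ∀ {D u v s} → u < D → v < s → u + v * D < s * D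
+-*-< {D} {u} {v} u<D v<s = ≤-trans (+-monoˡ-≤ (v * D) u<D) (*-monoˡ-≤ D v<s)

+-*-injective : ∀ {D u u' v v'} .{{_ : NonZero D}} → u < D → u' < D →
  u + v * D ≡ u' + v' * D → u ≡ u' × v ≡ v'
+-*-injective {D} {u} {u'} {v} {v'} u<D u'<D e =
  u≡u' , *-cancelʳ-≡ v v' D (+-cancelˡ-≡ u (v * D) (v' * D) (trans e (cong (_+ v' * D) (sym u≡u'))))
  where
  digit : ∀ {u v} → u < D → (u + v * D) % D ≡ u
  digit {u} {v} u<D = trans ([m+kn]%n≡m%n u v D) (m<n⇒m%n≡m u<D)
  u≡u' : u ≡ u'
  u≡u' = trans (sym (digit {v = v} u<D)) (trans (cong (_% D) e) (digit {v = v'} u'<D))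

sum₃ : (ℕ → ℕ) → ℕ → ℕ
sum₃ f x = f x + f (1 + x) + f (2 + x)

window : (ℕ → ℕ → ℕ) → ℕ → ℕ → ℕ
window F a b = sum₃ (λ i → sum₃ (F i) b) a

sum₃-cong : ∀ {f g} → (∀ x → f x ≡ g x) → ∀ x → sum₃ f x ≡ sum₃ g x
sum₃-cong f≗g x = cong₂ _+_ (cong₂ _+_ (f≗g x) (f≗g (1 + x))) (f≗g (2 + x))

sum₃-+ : ∀ f g x → sum₃ (λ y → f y + g y) x ≡ sum₃ f x + sum₃ g x
sum₃-+ f g x = regroup (f x) (f (1 + x)) (f (2 + x)) (g x) (g (1 + x)) (g (2 + x))
  where
  regroup : ∀ a b c d e h → a + d + (b + e) + (c + h) ≡ a + b + c + (d + e + h)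
  regroup = solve-∀

sum₃-* : ∀ c f x → sum₃ (λ y → f y * c) x ≡ sum₃ f x * c
sum₃-* c f x = sym (trans (*-distribʳ-+ c (f x + f (1 + x)) (f (2 + x)))
                          (cong (_+ f (2 + x) * c) (*-distribʳ-+ c (f x) (f (1 + x)))))

sum₃-comm : ∀ (F : ℕ → ℕ → ℕ) a b →
  sum₃ (λ i → sum₃ (F i) b) a ≡ sum₃ (λ j → sum₃ (λ i → F i j) a) b
sum₃-comm F a b =
  trans (sum₃-+ (λ i → F i b + F i (1 + b)) (λ i → F i (2 + b)) a)
        (cong (_+ sum₃ (λ i → F i (2 + b)) a) (sum₃-+ (λ i → F i b) (λ i → F i (1 + b)) a))

window-transpose : ∀ (F : ℕ → ℕ → ℕ) a b → window (λ i j → F j i) a b ≡ window F b a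
window-transpose F a b = sum₃-comm (λ i j → F j i) a b

window-+ : ∀ (F G : ℕ → ℕ → ℕ) a b →
  window (λ i j → F i j + G i j) a b ≡ window F a b + window G a b
window-+ F G a b =
  trans (sum₃-cong (λ i → sum₃-+ (F i) (G i) b) a) (sum₃-+ (λ i → sum₃ (F i) b) (λ i → sum₃ (G i) b) a)

∑ℕ-triples : ∀ s f → ∑ℕ (s * 3) f ≡ ∑ℕ s (λ p → sum₃ f (p * 3))
∑ℕ-triples zero    f = refl
∑ℕ-triples (suc s) f =
  trans (regroup (f 0) (f 1) (f 2) _) (cong (sum₃ f 0 +_) (∑ℕ-triples s (λ x → f (3 + x))))
  where
  regroup : ∀ a b c x → a + (b + (c + x)) ≡ a + b + c + x
  regroup = solve-∀

sum₃-∑ℕ : ∀ t (F : ℕ → ℕ → ℕ) x → sum₃ (λ a → ∑ℕ t (F a)) x ≡ ∑ℕ t (λ q → sum₃ (λ a → F a q) x)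
sum₃-∑ℕ t F x = sym (trans (∑-distrib-+ {t} (λ i → F x (toℕ i) + F (1 + x) (toℕ i)) (F (2 + x) ∘ toℕ))
                          (cong (_+ ∑ℕ t (F (2 + x))) (∑-distrib-+ {t} (F x ∘ toℕ) (F (1 + x) ∘ toℕ))))

∑ℕ-3 : ∀ f → ∑ℕ 3 f ≡ sum₃ f 0
∑ℕ-3 f = regroup (f 0) (f 1) (f 2)
  where
  regroup : ∀ a b c → a + (b + (c + 0)) ≡ a + b + c
  regroup = solve-∀

∑-tiles : ∀ s t (φ : ℕ → ℕ → ℕ) k → (∀ a b → window φ a b ≡ k) →
  ∑ℕ (s * 3) (λ a → ∑ℕ (t * 3) (φ a)) ≡ s * (t * k)
∑-tiles s t φ k window-constant = begin
  ∑ℕ (s * 3) (λ a → ∑ℕ (t * 3) (φ a))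
    ≡⟨ ∑ℕ-cong (s * 3) (λ a → ∑ℕ-triples t (φ a)) ⟩
  ∑ℕ (s * 3) (λ a → ∑ℕ t (λ q → sum₃ (φ a) (q * 3)))
    ≡⟨ ∑ℕ-triples s (λ a → ∑ℕ t (λ q → sum₃ (φ a) (q * 3))) ⟩
  ∑ℕ s (λ p → sum₃ (λ a → ∑ℕ t (λ q → sum₃ (φ a) (q * 3))) (p * 3))
    ≡⟨ ∑ℕ-cong s (λ p → sum₃-∑ℕ t (λ a q → sum₃ (φ a) (q * 3)) (p * 3)) ⟩
  ∑ℕ s (λ p → ∑ℕ t (λ q → window φ (p * 3) (q * 3)))
    ≡⟨ ∑ℕ-cong s (λ p → ∑ℕ-cong t (window-constant (p * 3) ∘ (_* 3))) ⟩
  ∑ℕ s (λ _ → ∑ℕ t (λ _ → k))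
    ≡⟨ ∑ℕ-cong s (λ _ → ∑ℕ-const t k) ⟩
  ∑ℕ s (λ _ → t * k)
    ≡⟨ ∑ℕ-const s (t * k) ⟩
  s * (t * k) ∎
  where open ≡-Reasoning

Periodic : ℕ → (ℕ → ℕ) → Set
Periodic p f = ∀ x → f (p + x) ≡ f x

periodic-* : ∀ {p f} → Periodic p f → ∀ t → Periodic (t * p) f
periodic-*         per zero    x = refl
periodic-* {p} {f} per (suc t) x =
  trans (cong f (+-assoc p (t * p) x)) (trans (per (t * p + x)) (periodic-* per t x))

periodic-cancel : ∀ {p q f} → Periodic (p + q) f → Periodic q f → Periodic p f
periodic-cancel {p} {q} {f} per-p+q per-q x =
  trans (sym (per-q (p + x))) (trans (cong f (regroup p q x)) (per-p+q x))
  where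
  regroup : ∀ p q x → q + (p + x) ≡ p + q + x
  regroup = solve-∀

-- 1 = N − 3⌊N/3⌋ or 1 = 2N − 3(2⌊N/3⌋ + 1).
periodic-1 : ∀ {N f} → Periodic N f → Periodic 3 f → N % 3 ≢ 0 → Periodic 1 f
periodic-1 {N} {f} per-N per-3 N%3≢0 with N % 3 | m≡m%n+[m/n]*n N 3 | m%n<n N 3
... | 0 | _   | _ = contradiction refl N%3≢0
... | 1 | N≡ | _ = periodic-cancel (subst (λ p → Periodic p f) N≡ per-N) (periodic-* per-3 (N / 3))
... | 2 | N≡ | _ =
  periodic-cancel (subst (λ p → Periodic p f) 2N≡ (periodic-* per-N 2)) (periodic-* per-3 (1 + N / 3 * 2))
  where
  2N≡ : 2 * N ≡ 1 + (1 + N / 3 * 2) * 3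
  2N≡ = trans (cong (2 *_) N≡) (double (N / 3))
    where
    double : ∀ q → 2 * (2 + q * 3) ≡ 1 + (1 + q * 2) * 3
    double = solve-∀
... | suc (suc (suc _)) | _ | s≤s (s≤s (s≤s ()))

periodic-% : ∀ {p f} .{{_ : NonZero p}} → Periodic p f → ∀ x → f (x % p) ≡ f x
periodic-% {p} {f} per x =
  sym (trans (cong f (trans (m≡m%n+[m/n]*n x p) (+-comm (x % p) (x / p * p)))) (periodic-* per (x / p) (x % p)))

sum₃-constant⇒periodic-3 : ∀ {f} → (∀ x → sum₃ f x ≡ sum₃ f (1 + x)) → Periodic 3 f
sum₃-constant⇒periodic-3 {f} const x = +-cancelˡ-≡ (f (1 + x) + f (2 + x)) (f (3 + x)) (f x)
  (trans (sym (const x)) (rotate (f x) (f (1 + x)) (f (2 + x))))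
  where
  rotate : ∀ a b c → a + b + c ≡ b + c + a
  rotate = solve-∀

periodic-3⇒sum₃-constant : ∀ {f} → Periodic 3 f → ∀ x → sum₃ f x ≡ sum₃ f 0
periodic-3⇒sum₃-constant         per zero    = refl
periodic-3⇒sum₃-constant {f} per (suc x) =
  trans (cong (f (1 + x) + f (2 + x) +_) (per x))
        (trans (rotate (f x) (f (1 + x)) (f (2 + x))) (periodic-3⇒sum₃-constant per x))
  where
  rotate : ∀ a b c → b + c + a ≡ a + b + c
  rotate = solve-∀

sum₃-mod-3 : ∀ (H : ℕ → ℕ) x → sum₃ (λ y → H (y % 3)) x ≡ H 0 + H 1 + H 2
sum₃-mod-3 H = periodic-3⇒sum₃-constant (λ x → cong H ([n+m]%n≡m%n 3 x))

sum₃-periodic-1 : ∀ {f} → Periodic 1 f → ∀ x → sum₃ f x ≡ 3 * f x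
sum₃-periodic-1 {f} per x =
  trans (cong₂ (λ b c → f x + b + c) (per x) (trans (per (1 + x)) (per x))) (triple (f x))
  where
  triple : ∀ a → a + a + a ≡ 3 * a
  triple = solve-∀

-- Closed neighbourhoods in strong products of cycles

closedNbhdSum≡∑ : ∀ G (g : V G → ℕ) x → closedNbhdSum G g x ≡
  ∑[ i < size G ] (if closedAdj G x (Inverse.to (enum G) i) then g (Inverse.to (enum G) i) else 0)
closedNbhdSum≡∑ G g x = trans (cong List.sum (sym (map-∘ (allFin (size G))))) (sum-map-allFin (size G) _)

⌊combine≟combine⌋ : ∀ {m n} (i i' : Fin m) (j j' : Fin n) →
  ⌊ combine i j ≟ combine i' j' ⌋ ≡ ⌊ i ≟ i' ⌋ ∧ ⌊ j ≟ j' ⌋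
⌊combine≟combine⌋ i i' j j' = begin
  ⌊ combine i j ≟ combine i' j' ⌋     ≡⟨ isYes≗does (combine i j ≟ combine i' j') ⟩
  does (combine i j ≟ combine i' j')  ≡⟨ does-⇔ combine≡⇔ (combine i j ≟ combine i' j') (i ≟ i' ×-dec j ≟ j') ⟩
  does (i ≟ i') ∧ does (j ≟ j')        ≡⟨ cong₂ _∧_ (isYes≗does (i ≟ i')) (isYes≗does (j ≟ j')) ⟨
  ⌊ i ≟ i' ⌋ ∧ ⌊ j ≟ j' ⌋              ∎
  where
  open ≡-Reasoning
  combine≡⇔ : combine i j ≡ combine i' j' ⇔ (i ≡ i' × j ≡ j')
  combine≡⇔ = mk⇔ (combine-injective i j i' j') λ { (refl , refl) → refl }

∧-∨-expand : ∀ a b c d → ((c ∧ b) ∨ (d ∧ a) ∨ (a ∧ b)) ∨ (c ∧ d) ≡ (a ∨ c) ∧ (b ∨ d)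
∧-∨-expand true  true  true  true  = refl
∧-∨-expand true  true  true  false = refl
∧-∨-expand true  true  false true  = refl
∧-∨-expand true  true  false false = refl
∧-∨-expand true  false true  true  = refl
∧-∨-expand true  false true  false = refl
∧-∨-expand true  false false true  = refl
∧-∨-expand true  false false false = refl
∧-∨-expand false true  true  true  = refl
∧-∨-expand false true  true  false = refl
∧-∨-expand false true  false true  = refl
∧-∨-expand false true  false false = refl
∧-∨-expand false false true  true  = refl
∧-∨-expand false false true  false = refl
∧-∨-expand false false false true  = refl
∧-∨-expand false false false false = refl

closedAdj-⊠ : ∀ G H {g g' h h'} →
  closedAdj (G ⊠ H) (g , h) (g' , h') ≡ closedAdj G g g' ∧ closedAdj H h h'
closedAdj-⊠ G H {g} {g'} {h} {h'} =
  trans (cong (adjacent ∨_) (⌊combine≟combine⌋ (from G g) (from G g') (from H h) (from H h')))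
        (∧-∨-expand (adj G g g') (adj H h h') _ _)
  where
  adjacent = adj (G ⊠ H) (g , h) (g' , h')
  from : ∀ G → V G → Fin (size G)
  from G = Inverse.from (enum G)

closedNbhdSum-⊠ : ∀ G H (f : V G × V H → ℕ) g h →
  closedNbhdSum (G ⊠ H) f (g , h) ≡ closedNbhdSum G (λ g' → closedNbhdSum H (λ h' → f (g' , h')) h) g
closedNbhdSum-⊠ G H f g h = begin
  closedNbhdSum (G ⊠ H) f (g , h)
    ≡⟨ closedNbhdSum≡∑ (G ⊠ H) f (g , h) ⟩
  ∑[ k < size G * size H ] (if closedAdj (G ⊠ H) (g , h) (to⊠ k) then f (to⊠ k) else 0)
    ≡⟨ sum-cong-≗ (λ k → cong (λ b → if b then f (to⊠ k) else 0) (closedAdj-⊠ G H)) ⟩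
  ∑[ k < size G * size H ] term (remQuot (size H) k)
    ≡⟨ ∑-remQuot (size G) (size H) term ⟩
  ∑[ i < size G ] ∑[ j < size H ] (if inG i ∧ inH j then f (toG i , toH j) else 0)
    ≡⟨ sum-cong-≗ (λ i → ∑-if-∧ (inG i)) ⟩
  ∑[ i < size G ] (if inG i then ∑[ j < size H ] (if inH j then f (toG i , toH j) else 0) else 0)
    ≡⟨ sum-cong-≗ (λ i → cong (λ s → if inG i then s else 0) (closedNbhdSum≡∑ H (f ∘ (toG i ,_)) h)) ⟨
  ∑[ i < size G ] (if inG i then closedNbhdSum H (λ h' → f (toG i , h')) h else 0)
    ≡⟨ closedNbhdSum≡∑ G (λ g' → closedNbhdSum H (λ h' → f (g' , h')) h) g ⟨
  closedNbhdSum G (λ g' → closedNbhdSum H (λ h' → f (g' , h')) h) g ∎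
  where
  open ≡-Reasoning
  toG = Inverse.to (enum G)
  toH = Inverse.to (enum H)
  to⊠ = Inverse.to (enum (G ⊠ H))
  inG : Fin (size G) → Bool
  inG i = closedAdj G g (toG i)
  inH : Fin (size H) → Bool
  inH j = closedAdj H h (toH j)
  term : Fin (size G) × Fin (size H) → ℕ
  term (i , j) = if inG i ∧ inH j then f (toG i , toH j) else 0
  ∑-if-∧ : ∀ {i} b → ∑[ j < size H ] (if b ∧ inH j then f (toG i , toH j) else 0)
                   ≡ (if b then ∑[ j < size H ] (if inH j then f (toG i , toH j) else 0) else 0)
  ∑-if-∧ true  = refl
  ∑-if-∧ false = sum-replicate-zero (size H)

⌊⌋-true : ∀ {A : Set} (a? : Dec A) → A → ⌊ a? ⌋ ≡ true
⌊⌋-true (yes _) _ = refl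
⌊⌋-true (no ¬a) a = contradiction a ¬a

module _ (n : ℕ) (a : ℕ) where
  private
    M = 3 + n
    u = a mod M
    x = suc a mod M
    w = (2 + a) mod M

    suc-toℕ-mod : ∀ b → suc (toℕ (b mod M)) % M ≡ suc b % M
    suc-toℕ-mod b = trans (cong (λ r → suc r % M) (toℕ-mod b M)) (%-absorbʳ 1 b M)

    x~u : closedAdj (Cycle M) x u ≡ true
    x~u = cong (_∨ ⌊ x ≟ u ⌋) (trans (cong (⌊ toℕ u ℕ.≟ suc (toℕ x) % M ⌋ ∨_)
            (⌊⌋-true (toℕ x ℕ.≟ suc (toℕ u) % M) (trans (toℕ-mod (suc a) M) (sym (suc-toℕ-mod a)))))
          (∨-zeroʳ _))

    x~x : closedAdj (Cycle M) x x ≡ true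
    x~x = trans (cong (cycAdj M x x ∨_) (⌊⌋-true (x ≟ x) refl)) (∨-zeroʳ _)

    x~w : closedAdj (Cycle M) x w ≡ true
    x~w = cong (λ b → (b ∨ ⌊ toℕ x ℕ.≟ suc (toℕ w) % M ⌋) ∨ ⌊ x ≟ w ⌋)
            (⌊⌋-true (toℕ w ℕ.≟ suc (toℕ x) % M) (trans (toℕ-mod (2 + a) M) (sym (suc-toℕ-mod (suc a)))))

    closedAdj⇒∈ : ∀ j → closedAdj (Cycle M) x j ≡ true → j ≡ u ⊎ j ≡ x ⊎ j ≡ w
    closedAdj⇒∈ j x~j with toℕ j ℕ.≟ suc (toℕ x) % M | toℕ x ℕ.≟ suc (toℕ j) % M | x ≟ j
    ... | yes e | _     | _     =
      inj₂ (inj₂ (toℕ-injective (trans e (trans (suc-toℕ-mod (suc a)) (sym (toℕ-mod (2 + a) M))))))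
    ... | no _  | yes e | _     = inj₁ (toℕ-injective (trans j≡a%M (sym (toℕ-mod a M))))
      where
      j≡a%M : toℕ j ≡ a % M
      j≡a%M = suc-%-injective (toℕ<n j) (m%n<n a M)
                (trans (sym e) (trans (toℕ-mod (suc a) M) (sym (%-absorbʳ 1 a M))))
    ... | no _  | no _  | yes e = inj₂ (inj₁ (sym e))
    ... | no _  | no _  | no _  = contradiction x~j λ ()

  closedNbhdSum-Cycle : ∀ (g : Fin (3 + n) → ℕ) →
    closedNbhdSum (Cycle (3 + n)) g (suc a mod (3 + n)) ≡ sum₃ (λ i → g (i mod (3 + n))) a
  closedNbhdSum-Cycle g = trans (closedNbhdSum≡∑ (Cycle M) g x)
    (∑-if-three (closedAdj (Cycle M) x) g (mod-shift-≢ 0<1 1<M a) (mod-shift-≢ 0<2 2<M a)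
       (mod-shift-≢ 0<1 1<M (suc a)) x~u x~x x~w closedAdj⇒∈)
    where
    0<1 : 0 < 1
    0<1 = s≤s z≤n
    0<2 : 0 < 2
    0<2 = s≤s z≤n
    1<M : 1 < M
    1<M = s≤s (s≤s z≤n)
    2<M : 2 < M
    2<M = s≤s (s≤s (s≤s z≤n))

closedNbhdSum-torus : ∀ m n (f : Fin (3 + m) × Fin (3 + n) → ℕ) a b →
  closedNbhdSum (Cycle (3 + m) ⊠ Cycle (3 + n)) f (suc a mod (3 + m) , suc b mod (3 + n))
    ≡ window (λ i j → f (i mod (3 + m) , j mod (3 + n))) a b
closedNbhdSum-torus m n f a b =
  trans (closedNbhdSum-⊠ (Cycle (3 + m)) (Cycle (3 + n)) f (suc a mod (3 + m)) (suc b mod (3 + n)))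
  (trans (closedNbhdSum-Cycle m a (λ i → closedNbhdSum (Cycle (3 + n)) (λ j → f (i , j)) (suc b mod (3 + n))))
         (sum₃-cong (λ i → closedNbhdSum-Cycle n b (λ j → f (i mod (3 + m) , j))) a))

-- Magic labellings of the torus

-- φ a b + 1 is the label of the vertex (a mod m , b mod n) of C_m ⊠ C_n, so the window sums of φ
-- are the closed neighbourhood sums lowered by 9.
record MagicTorusLabelling (m n : ℕ) (φ : ℕ → ℕ → ℕ) (k : ℕ) : Set where
  field
    periodic₁       : ∀ b → Periodic m (λ a → φ a b)
    periodic₂       : ∀ a → Periodic n (φ a)
    bounded         : ∀ a b → φ a b < m * n
    injective       : ∀ {a b a' b'} → a < m → b < n → a' < m → b' < n →
                      φ a b ≡ φ a' b' → a ≡ a' × b ≡ b'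
    window-constant : ∀ a b → window φ a b ≡ k

transpose : ∀ {m n φ k} → MagicTorusLabelling m n φ k → MagicTorusLabelling n m (λ a b → φ b a) k
transpose {m} {n} {φ} L = record
  { periodic₁       = periodic₂
  ; periodic₂       = periodic₁
  ; bounded         = λ a b → subst (φ b a <_) (*-comm m n) (bounded b a)
  ; injective       = λ a<n b<m a'<n b'<m e → swap (injective b<m a<n b'<m a'<n e)
  ; window-constant = λ a b → trans (window-transpose φ a b) (window-constant b a)
  }
  where open MagicTorusLabelling L

module _ {m n φ k} (L : MagicTorusLabelling m n φ k) where
  open MagicTorusLabelling L

  labelBijection : (Fin m × Fin n) ↔ Fin (m * n)
  labelBijection = injection⇒↔ (↔-sym *↔×) label label-injective
    where
    label : Fin m × Fin n → Fin (m * n)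
    label (i , j) = fromℕ< (bounded (toℕ i) (toℕ j))
    label-injective : Injective _≡_ _≡_ label
    label-injective {i , j} {i' , j'} e
      with i≡i' , j≡j' ← injective (toℕ<n i) (toℕ<n j) (toℕ<n i') (toℕ<n j')
                           (trans (sym (toℕ-fromℕ< _)) (trans (cong toℕ e) (toℕ-fromℕ< _)))
      = cong₂ _,_ (toℕ-injective i≡i') (toℕ-injective j≡j')

  toℕ-labelBijection : ∀ i j → toℕ (Inverse.to labelBijection (i , j)) ≡ φ (toℕ i) (toℕ j)
  toℕ-labelBijection i j = toℕ-fromℕ< _

  ∑-labels : 2 * ∑ℕ m (λ a → ∑ℕ n (φ a)) + m * n ≡ m * n * (m * n)
  ∑-labels = trans (cong (λ S → 2 * S + m * n) ∑-grid) (∑ℕ-id (m * n))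
    where
    open ≡-Reasoning
    ℓ = Inverse.to labelBijection
    ∑-grid : ∑ℕ m (λ a → ∑ℕ n (φ a)) ≡ ∑ℕ (m * n) id
    ∑-grid = begin
      ∑[ i < m ] ∑[ j < n ] φ (toℕ i) (toℕ j)  ≡⟨ sum-cong-≗ {m} (sum-cong-≗ {n} ∘ toℕ-labelBijection) ⟨
      ∑[ i < m ] ∑[ j < n ] toℕ (ℓ (i , j))    ≡⟨ ∑-remQuot m n (toℕ ∘ ℓ) ⟨
      ∑[ x < m * n ] toℕ (ℓ (remQuot n x))     ≡⟨ sum-permute toℕ (↔-trans *↔× labelBijection) ⟨
      ∑[ x < m * n ] toℕ x                     ∎

labelling⇒closedDistanceMagic : ∀ {m n φ k} → MagicTorusLabelling (3 + m) (3 + n) φ k →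
  ClosedDistanceMagic (Cycle (3 + m) ⊠ Cycle (3 + n))
labelling⇒closedDistanceMagic {m} {n} {φ} {k} L = labelBijection L , 9 + k , s≤s z≤n , magic
  where
  open MagicTorusLabelling L
  label : Fin (3 + m) × Fin (3 + n) → ℕ
  label v = suc (toℕ (Inverse.to (labelBijection L) v))
  label-mod : ∀ i j → label (i mod (3 + m) , j mod (3 + n)) ≡ suc (φ i j)
  label-mod i j = cong suc (trans (toℕ-labelBijection L _ _) (trans
    (cong₂ φ (toℕ-mod i (3 + m)) (toℕ-mod j (3 + n)))
    (trans (periodic-% (periodic₁ (j % (3 + n))) i) (periodic-% (periodic₂ i) j))))
  magic : ∀ v → closedNbhdSum (Cycle (3 + m) ⊠ Cycle (3 + n)) label v ≡ 9 + k
  magic (x , y) = begin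
    closedNbhdSum (Cycle (3 + m) ⊠ Cycle (3 + n)) label (x , y)
      ≡⟨ cong₂ (λ x y → closedNbhdSum (Cycle (3 + m) ⊠ Cycle (3 + n)) label (x , y))
               (suc-mod-surjective x) (suc-mod-surjective y) ⟨
    closedNbhdSum (Cycle (3 + m) ⊠ Cycle (3 + n)) label (suc a mod (3 + m) , suc b mod (3 + n))
      ≡⟨ closedNbhdSum-torus m n label a b ⟩
    window (λ i j → label (i mod (3 + m) , j mod (3 + n))) a b
      ≡⟨ sum₃-cong (λ i → sum₃-cong (label-mod i) b) a ⟩
    window (λ i j → 1 + φ i j) a b
      ≡⟨ window-+ (λ _ _ → 1) φ a b ⟩
    9 + window φ a b
      ≡⟨ cong (9 +_) (window-constant a b) ⟩
    9 + k ∎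
    where
    open ≡-Reasoning
    a = toℕ x + (2 + m)
    b = toℕ y + (2 + n)

closedDistanceMagic⇒labelling : ∀ {m n} → ClosedDistanceMagic (Cycle (3 + m) ⊠ Cycle (3 + n)) →
  ∃₂ λ φ k → MagicTorusLabelling (3 + m) (3 + n) φ k
closedDistanceMagic⇒labelling {m} {n} (ℓ , k' , _ , magic) = φ , k' ∸ 9 , record
  { periodic₁       = λ b x → cong (λ i → toℕ (to ℓ (i , b mod N))) (mod-periodic M x)
  ; periodic₂       = λ a x → cong (λ j → toℕ (to ℓ (a mod M , j))) (mod-periodic N x)
  ; bounded         = λ a b → toℕ<n (to ℓ (a mod M , b mod N))
  ; injective       = λ a<M b<N a'<M b'<N e →
      let a≡a' , b≡b' = ,-injective (Injection.injective (↔⇒↣ ℓ) (toℕ-injective e))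
      in mod-injective a<M a'<M a≡a' , mod-injective b<N b'<N b≡b'
  ; window-constant = λ a b → trans (sym (m+n∸m≡n 9 (window φ a b))) (cong (_∸ 9) (9+window≡k' a b))
  }
  where
  open Inverse using (to)
  M = 3 + m
  N = 3 + n
  φ : ℕ → ℕ → ℕ
  φ a b = toℕ (to ℓ (a mod M , b mod N))
  9+window≡k' : ∀ a b → 9 + window φ a b ≡ k'
  9+window≡k' a b = begin
    9 + window φ a b                 ≡⟨ window-+ (λ _ _ → 1) φ a b ⟨
    window (λ i j → suc (φ i j)) a b  ≡⟨ closedNbhdSum-torus m n (λ v → suc (toℕ (to ℓ v))) a b ⟨
    closedNbhdSum (Cycle M ⊠ Cycle N) (λ v → suc (toℕ (to ℓ v))) (suc a mod M , suc b mod N)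
                                     ≡⟨ magic (suc a mod M , suc b mod N) ⟩
    k'                               ∎
    where open ≡-Reasoning

-- Necessity

module _ {m n φ k} (L : MagicTorusLabelling m n φ k) where
  open MagicTorusLabelling L

  private module _ (m%3≢0 : m % 3 ≢ 0) where
    3*sum₃≡k : ∀ a b → 3 * sum₃ (φ a) b ≡ k
    3*sum₃≡k a b = trans (sym (sum₃-periodic-1 (periodic-1 per-m per-3 m%3≢0) a)) (window-constant a b)
      where
      per-m : Periodic m (λ a → sum₃ (φ a) b)
      per-m x = sum₃-cong (λ y → periodic₁ y x) b
      per-3 : Periodic 3 (λ a → sum₃ (φ a) b)
      per-3 = sum₃-constant⇒periodic-3 (λ a → trans (window-constant a b) (sym (window-constant (1 + a) b)))

    rows-periodic-3 : ∀ a → Periodic 3 (φ a)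
    rows-periodic-3 a = sum₃-constant⇒periodic-3 λ b →
      *-cancelˡ-≡ _ _ 3 (trans (3*sum₃≡k a b) (sym (3*sum₃≡k a (1 + b))))

    n≡3 : 0 < m → 3 ≤ n → n ≡ 3
    n≡3 0<m n≥3 with n ℕ.≟ 3
    ... | yes n≡3 = n≡3
    ... | no  n≢3 = contradiction (proj₂ (injective 0<m 0<n 0<m 3<n (sym (rows-periodic-3 0 0)))) λ ()
      where
      0<n : 0 < n
      0<n = ≤-trans (s≤s z≤n) n≥3
      3<n : 3 < n
      3<n = ≤∧≢⇒< n≥3 (n≢3 ∘ sym)

    m%2≡1 : 0 < m → n ≡ 3 → m % 2 ≡ 1
    m%2≡1 0<m n≡3 = begin
      m % 2            ≡⟨ odd-*-%2 4 m ⟨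
      (9 * m) % 2      ≡⟨ cong (_% 2) 3+2c≡9m ⟨
      (3 + c * 2) % 2  ≡⟨ [m+kn]%n≡m%n 3 c 2 ⟩
      1                ∎
      where
      open ≡-Reasoning
      instance
        _ = >-nonZero 0<m
      c = sum₃ (φ 0) 0
      row≡c : ∀ a → ∑ℕ n (φ a) ≡ c
      row≡c a = begin
        ∑ℕ n (φ a)     ≡⟨ cong (λ n → ∑ℕ n (φ a)) n≡3 ⟩
        ∑ℕ 3 (φ a)     ≡⟨ ∑ℕ-3 (φ a) ⟩
        sum₃ (φ a) 0   ≡⟨ *-cancelˡ-≡ _ _ 3 (trans (3*sum₃≡k a 0) (sym (3*sum₃≡k 0 0))) ⟩
        c              ∎
      ∑rows≡m*c : ∑ℕ m (λ a → ∑ℕ n (φ a)) ≡ m * c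
      ∑rows≡m*c = trans (∑ℕ-cong m row≡c) (∑ℕ-const m c)
      3+2c≡9m : 3 + c * 2 ≡ 9 * m
      3+2c≡9m = *-cancelˡ-≡ _ _ m (begin
        m * (3 + c * 2)                    ≡⟨ expand m c ⟩
        2 * (m * c) + m * 3                ≡⟨ cong₂ (λ S n → 2 * S + m * n) ∑rows≡m*c n≡3 ⟨
        2 * ∑ℕ m (λ a → ∑ℕ n (φ a)) + m * n ≡⟨ ∑-labels L ⟩
        m * n * (m * n)                    ≡⟨ cong (λ n → m * n * (m * n)) n≡3 ⟩
        m * 3 * (m * 3)                    ≡⟨ square m ⟩
        m * (9 * m)                        ∎)
        where
        expand : ∀ m c → m * (3 + c * 2) ≡ 2 * (m * c) + m * 3
        expand = solve-∀
        square : ∀ m → m * 3 * (m * 3) ≡ m * (9 * m)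
        square = solve-∀

  m%3≢0⇒n≡3×m%2≡1 : 3 ≤ m → 3 ≤ n → m % 3 ≢ 0 → n ≡ 3 × m % 2 ≡ 1
  m%3≢0⇒n≡3×m%2≡1 m≥3 n≥3 m%3≢0 = n≡3′ , m%2≡1 m%3≢0 0<m n≡3′
    where
    0<m : 0 < m
    0<m = ≤-trans (s≤s z≤n) m≥3
    n≡3′ = n≡3 m%3≢0 0<m n≥3

  m%3≡n%3≡0⇒m%6≡n%6≡3 : 3 ≤ m → 3 ≤ n → m % 3 ≡ 0 → n % 3 ≡ 0 → m % 6 ≡ 3 × n % 6 ≡ 3
  m%3≡n%3≡0⇒m%6≡n%6≡3 m≥3 n≥3 m%3≡0 n%3≡0 =
    subst (λ m → m % 6 ≡ 3) (sym m≡s*3) (odd-*3-%6 s s%2≡1) ,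
    subst (λ n → n % 6 ≡ 3) (sym n≡t*3) (odd-*3-%6 t t%2≡1)
    where
    open ≡-Reasoning
    s = m / 3
    t = n / 3
    m≡s*3 : m ≡ s * 3
    m≡s*3 = m%n≡r⇒m≡r+[m/n]*n m%3≡0
    n≡t*3 : n ≡ t * 3
    n≡t*3 = m%n≡r⇒m≡r+[m/n]*n n%3≡0
    instance
      _ = >-nonZero (m≥n⇒m/n>0 m≥3)
      _ = >-nonZero (m≥n⇒m/n>0 n≥3)
      _ = m*n≢0 s t
    9+2k≡81st : 9 + k * 2 ≡ 81 * (s * t)
    9+2k≡81st = *-cancelˡ-≡ _ _ (s * t) (begin
      s * t * (9 + k * 2)                ≡⟨ expand s t k ⟩
      2 * (s * (t * k)) + s * 3 * (t * 3)
                                         ≡⟨ cong₂ (λ S N → 2 * S + N) ∑-tiling (cong₂ _*_ m≡s*3 n≡t*3) ⟨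
      2 * ∑ℕ m (λ a → ∑ℕ n (φ a)) + m * n ≡⟨ ∑-labels L ⟩
      m * n * (m * n)                    ≡⟨ cong₂ (λ m n → m * n * (m * n)) m≡s*3 n≡t*3 ⟩
      s * 3 * (t * 3) * (s * 3 * (t * 3)) ≡⟨ square s t ⟩
      s * t * (81 * (s * t))             ∎)
      where
      ∑-tiling : ∑ℕ m (λ a → ∑ℕ n (φ a)) ≡ s * (t * k)
      ∑-tiling = trans (cong₂ (λ m n → ∑ℕ m (λ a → ∑ℕ n (φ a))) m≡s*3 n≡t*3)
                       (∑-tiles s t φ k window-constant)
      expand : ∀ s t k → s * t * (9 + k * 2) ≡ 2 * (s * (t * k)) + s * 3 * (t * 3)
      expand = solve-∀
      square : ∀ s t → s * 3 * (t * 3) * (s * 3 * (t * 3)) ≡ s * t * (81 * (s * t))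
      square = solve-∀
    st%2≡1 : (s * t) % 2 ≡ 1
    st%2≡1 = trans (sym (odd-*-%2 40 (s * t))) (trans (cong (_% 2) (sym 9+2k≡81st)) ([m+kn]%n≡m%n 9 k 2))
    s%2≡1 : s % 2 ≡ 1
    s%2≡1 = %2≡1-*ˡ s t st%2≡1
    t%2≡1 : t % 2 ≡ 1
    t%2≡1 = %2≡1-*ˡ t s (trans (cong (_% 2) (*-comm t s)) st%2≡1)

MagicSizes : ℕ → ℕ → Set
MagicSizes m n =
  (m % 6 ≡ 3 × n % 6 ≡ 3) ⊎ (Σ ℕ λ x → x % 2 ≡ 1 × ((m ≡ 3 × n ≡ x) ⊎ (m ≡ x × n ≡ 3)))

labelling⇒magicSizes : ∀ {m n φ k} → 3 ≤ m → 3 ≤ n → MagicTorusLabelling m n φ k → MagicSizes m n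
labelling⇒magicSizes {m} {n} m≥3 n≥3 L with m % 3 ℕ.≟ 0 | n % 3 ℕ.≟ 0
... | no m%3≢0 | _
  with n≡3 , m%2≡1 ← m%3≢0⇒n≡3×m%2≡1 L m≥3 n≥3 m%3≢0
  = inj₂ (m , m%2≡1 , inj₂ (refl , n≡3))
... | yes _ | no n%3≢0
  with m≡3 , n%2≡1 ← m%3≢0⇒n≡3×m%2≡1 (transpose L) n≥3 m≥3 n%3≢0
  = inj₂ (n , n%2≡1 , inj₁ (m≡3 , refl))
... | yes m%3≡0 | yes n%3≡0 = inj₁ (m%3≡n%3≡0⇒m%6≡n%6≡3 L m≥3 n≥3 m%3≡0 n%3≡0)

-- The construction

-- σ h 0 = id, σ h 1 and σ h 2 permute {0, …, 2h} and add up to 3h at every point: they are the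
-- rows of a 3 × (2h + 1) magic rectangle.
σ₁ : ℕ → ℕ → ℕ
σ₁ h x with x <? h
... | yes _ = x + suc h
... | no  _ = x ∸ h

σ₂ : ℕ → ℕ → ℕ
σ₂ h x with x <? h
... | yes _ = suc ((h ∸ suc x) * 2)
... | no  _ = (h * 2 ∸ x) * 2

σ : ℕ → ℕ → ℕ → ℕ
σ h zero          = id
σ h (suc zero)    = σ₁ h
σ h (suc (suc _)) = σ₂ h

data σ-View (h x : ℕ) : Set where
  lower : ∀ d → h ≡ suc (x + d) → σ₁ h x ≡ x + suc h → σ₂ h x ≡ suc (d * 2) → σ-View h x
  upper : ∀ e f → x ≡ h + e → h ≡ e + f → σ₁ h x ≡ e → σ₂ h x ≡ f * 2 → σ-View h x

σ-lower : ∀ {h x} → x < h → σ₁ h x ≡ x + suc h × σ₂ h x ≡ suc ((h ∸ suc x) * 2)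
σ-lower {h} {x} x<h with x <? h
... | yes _   = refl , refl
... | no  x≮h = contradiction x<h x≮h

σ-upper : ∀ {h x} → ¬ x < h → σ₁ h x ≡ x ∸ h × σ₂ h x ≡ (h * 2 ∸ x) * 2
σ-upper {h} {x} x≮h with x <? h
... | yes x<h = contradiction x<h x≮h
... | no  _   = refl , refl

σ-view : ∀ h x → x ≤ h * 2 → σ-View h x
σ-view h x x≤2h with x <? h
... | yes x<h = lower (h ∸ suc x) (sym (m+[n∸m]≡n x<h)) (proj₁ (σ-lower x<h)) (proj₂ (σ-lower x<h))
... | no  x≮h = upper e (h ∸ e) (sym h+e≡x) (sym (m+[n∸m]≡n e≤h)) (proj₁ (σ-upper x≮h))
                      (trans (proj₂ (σ-upper x≮h)) (cong (_* 2) 2h∸x≡h∸e))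
  where
  h≤x = ≮⇒≥ x≮h
  e = x ∸ h
  h+e≡x : h + e ≡ x
  h+e≡x = m+[n∸m]≡n h≤x
  2h≡h+h : h * 2 ≡ h + h
  2h≡h+h = trans (*-comm h 2) (cong (h +_) (+-identityʳ h))
  e≤h : e ≤ h
  e≤h = +-cancelˡ-≤ h e h (subst₂ _≤_ (sym h+e≡x) 2h≡h+h x≤2h)
  2h∸x≡h∸e : h * 2 ∸ x ≡ h ∸ e
  2h∸x≡h∸e = trans (cong₂ _∸_ 2h≡h+h (sym h+e≡x)) ([m+n]∸[m+o]≡n∸o h h e)

σ-sum : ∀ h x → x ≤ h * 2 → σ h 0 x + σ h 1 x + σ h 2 x ≡ h * 3
σ-sum h x x≤2h with σ-view h x x≤2h
... | lower d refl σ₁≡ σ₂≡ = trans (cong₂ (λ a b → x + a + b) σ₁≡ σ₂≡) (sum-lower x d)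
  where
  sum-lower : ∀ x d → x + (x + suc (suc (x + d))) + suc (d * 2) ≡ suc (x + d) * 3
  sum-lower = solve-∀
... | upper e f refl refl σ₁≡ σ₂≡ =
  trans (cong₂ (λ a b → e + f + e + a + b) σ₁≡ σ₂≡) (sum-upper e f)
  where
  sum-upper : ∀ e f → e + f + e + e + f * 2 ≡ (e + f) * 3
  sum-upper = solve-∀

σ₁-bounded : ∀ h x → x ≤ h * 2 → σ₁ h x ≤ h * 2
σ₁-bounded h x x≤2h with σ-view h x x≤2h
... | lower d refl σ₁≡ _ = ≤-trans (≤-reflexive σ₁≡) (≤-offset d (bound x d))
  where
  bound : ∀ x d → x + suc (suc (x + d)) + d ≡ suc (x + d) * 2
  bound = solve-∀
... | upper e f refl refl σ₁≡ _ = ≤-trans (≤-reflexive σ₁≡) (≤-offset (f + (e + f)) (bound e f))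
  where
  bound : ∀ e f → e + (f + (e + f)) ≡ (e + f) * 2
  bound = solve-∀

σ₂-bounded : ∀ h x → x ≤ h * 2 → σ₂ h x ≤ h * 2
σ₂-bounded h x x≤2h with σ-view h x x≤2h
... | lower d refl _ σ₂≡ = ≤-trans (≤-reflexive σ₂≡) (≤-offset (suc (x * 2)) (bound x d))
  where
  bound : ∀ x d → suc (d * 2) + suc (x * 2) ≡ suc (x + d) * 2
  bound = solve-∀
... | upper e f refl refl _ σ₂≡ = ≤-trans (≤-reflexive σ₂≡) (≤-offset (e * 2) (bound e f))
  where
  bound : ∀ e f → f * 2 + e * 2 ≡ (e + f) * 2
  bound = solve-∀

σ₁-lower≢upper : ∀ {h x e f} → h ≡ e + f → x + suc h ≢ e
σ₁-lower≢upper {h} {x} {e} {f} h≡e+f x+1+h≡e =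
  <⇒≱ (≤-trans (m≤n+m (suc h) x) (≤-reflexive x+1+h≡e)) (subst (e ≤_) (sym h≡e+f) (m≤m+n e f))

σ₁-injective : ∀ h {x y} → x ≤ h * 2 → y ≤ h * 2 → σ₁ h x ≡ σ₁ h y → x ≡ y
σ₁-injective h {x} {y} x≤2h y≤2h σx≡σy with σ-view h x x≤2h | σ-view h y y≤2h
... | lower _ _ σx≡ _ | lower _ _ σy≡ _ =
  +-cancelʳ-≡ (suc h) x y (trans (sym σx≡) (trans σx≡σy σy≡))
... | upper _ _ x≡ _ σx≡ _ | upper _ _ y≡ _ σy≡ _ =
  trans x≡ (trans (cong (h +_) (trans (sym σx≡) (trans σx≡σy σy≡))) (sym y≡))
... | lower _ _ σx≡ _ | upper _ _ _ h≡ σy≡ _ =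
  contradiction (trans (sym σx≡) (trans σx≡σy σy≡)) (σ₁-lower≢upper h≡)
... | upper _ _ _ h≡ σx≡ _ | lower _ _ σy≡ _ =
  contradiction (trans (sym σy≡) (trans (sym σx≡σy) σx≡)) (σ₁-lower≢upper h≡)

σ₂-injective : ∀ h {x y} → x ≤ h * 2 → y ≤ h * 2 → σ₂ h x ≡ σ₂ h y → x ≡ y
σ₂-injective h {x} {y} x≤2h y≤2h σx≡σy with σ-view h x x≤2h | σ-view h y y≤2h
... | lower d₁ h≡₁ _ σx≡ | lower d₂ h≡₂ _ σy≡ =
  +-cancelʳ-≡ d₁ x y (suc-injective (trans (sym h≡₁) (trans h≡₂ (cong (λ d → suc (y + d)) (sym d₁≡d₂)))))
  where
  d₁≡d₂ : d₁ ≡ d₂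
  d₁≡d₂ = *-cancelʳ-≡ d₁ d₂ 2 (suc-injective (trans (sym σx≡) (trans σx≡σy σy≡)))
... | upper e₁ f₁ x≡ h≡₁ _ σx≡ | upper e₂ f₂ y≡ h≡₂ _ σy≡ =
  trans x≡ (trans (cong (h +_) e₁≡e₂) (sym y≡))
  where
  f₁≡f₂ : f₁ ≡ f₂
  f₁≡f₂ = *-cancelʳ-≡ f₁ f₂ 2 (trans (sym σx≡) (trans σx≡σy σy≡))
  e₁≡e₂ : e₁ ≡ e₂
  e₁≡e₂ = +-cancelʳ-≡ f₁ e₁ e₂ (trans (sym h≡₁) (trans h≡₂ (cong (e₂ +_) (sym f₁≡f₂))))
... | lower d _ _ σx≡ | upper _ f _ _ _ σy≡ =
  contradiction (trans (sym σy≡) (trans (sym σx≡σy) σx≡)) (*2≢1+*2 f d)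
... | upper _ f _ _ _ σx≡ | lower d _ _ σy≡ =
  contradiction (trans (sym σx≡) (trans σx≡σy σy≡)) (*2≢1+*2 f d)

σ-bounded : ∀ h r {x} → x ≤ h * 2 → σ h r x ≤ h * 2
σ-bounded h zero          x≤2h = x≤2h
σ-bounded h (suc zero)    x≤2h = σ₁-bounded h _ x≤2h
σ-bounded h (suc (suc _)) x≤2h = σ₂-bounded h _ x≤2h

σ-injective : ∀ h r {x y} → x ≤ h * 2 → y ≤ h * 2 → σ h r x ≡ σ h r y → x ≡ y
σ-injective h zero          _    _    σx≡σy = σx≡σy
σ-injective h (suc zero)    x≤2h y≤2h σx≡σy = σ₁-injective h x≤2h y≤2h σx≡σy
σ-injective h (suc (suc _)) x≤2h y≤2h σx≡σy = σ₂-injective h x≤2h y≤2h σx≡σy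

σ-zero : ∀ r → σ 0 r 0 ≡ 0
σ-zero zero          = refl
σ-zero (suc zero)    = refl
σ-zero (suc (suc _)) = refl

σ-column-sum : ∀ g n .{{_ : NonZero n}} → 3 ∣ n ⊎ g ≡ 0 → ∀ {p} → p ≤ g * 2 → ∀ b →
  sum₃ (λ j → σ g (j % n % 3) p) b ≡ g * 3
σ-column-sum g n (inj₁ 3∣n) {p} p≤2g b = begin
  sum₃ (λ j → σ g (j % n % 3) p) b
    ≡⟨ sum₃-cong (λ j → cong (λ r → σ g r p) (m∣n⇒o%n%m≡o%m 3 n j 3∣n)) b ⟩
  sum₃ (λ j → σ g (j % 3) p) b       ≡⟨ sum₃-mod-3 (λ r → σ g r p) b ⟩
  σ g 0 p + σ g 1 p + σ g 2 p        ≡⟨ σ-sum g p p≤2g ⟩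
  g * 3                              ∎
  where open ≡-Reasoning
σ-column-sum .0 n (inj₂ refl) z≤n b = sum₃-cong (λ j → σ-zero (j % n % 3)) b

-- The label of (i , j) has the digits σ h (i % 3) j, i % 3 and σ g (j % 3) (i / 3) in the mixed
-- radix (n, 3, 2g + 1). On three consecutive cells of a column i % 3 takes each value once, so the
-- two low digits contribute 3h + 3n; on three consecutive cells of a row j % 3 does the same when
-- 3 ∣ n, so the high digits contribute 3g (trivially so when g = 0).
module Construction (g h : ℕ) where
  m n : ℕ
  m = suc (g * 2) * 3
  n = suc (h * 2)

  cell : ℕ → ℕ → ℕ
  cell i j = σ h (i % 3) j + i % 3 * n + σ g (j % 3) (i / 3) * (3 * n)

  φ lowPart highPart : ℕ → ℕ → ℕ
  φ a b = cell (a % m) (b % n)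
  lowPart a b = σ h (a % m % 3) (b % n) + a % m % 3 * n
  highPart a b = σ g (b % n % 3) (a % m / 3) * (3 * n)

  rowSum colSum K : ℕ
  rowSum = h * 3 + 3 * n
  colSum = g * 3 * (3 * n)
  K      = rowSum + rowSum + rowSum + (colSum + colSum + colSum)

  private
    3∣m : 3 ∣ m
    3∣m = divides (suc (g * 2)) refl

    j≤2h : ∀ {j} → j < n → j ≤ h * 2
    j≤2h = s≤s⁻¹

    i/3≤2g : ∀ {i} → i < m → i / 3 ≤ g * 2
    i/3≤2g i<m = s≤s⁻¹ (m<n*o⇒m/o<n i<m)

    lowDigits< : ∀ i {j} → j < n → σ h (i % 3) j + i % 3 * n < 3 * n
    lowDigits< i j<n = +-*-< (s≤s (σ-bounded h (i % 3) (j≤2h j<n))) (m%n<n i 3)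

  cell-bounded : ∀ {i j} → i < m → j < n → cell i j < m * n
  cell-bounded {i} {j} i<m j<n = subst (cell i j <_) (sym (*-assoc (suc (g * 2)) 3 n))
    (+-*-< (lowDigits< i j<n) (s≤s (σ-bounded g (j % 3) (i/3≤2g i<m))))

  cell-injective : ∀ {i j i' j'} → i < m → j < n → i' < m → j' < n →
    cell i j ≡ cell i' j' → i ≡ i' × j ≡ j'
  cell-injective {i} {j} {i'} {j'} i<m j<n i'<m j'<n e = i≡i' , j≡j'
    where
    high = +-*-injective (lowDigits< i j<n) (lowDigits< i' j'<n) e
    low  = +-*-injective (s≤s (σ-bounded h (i % 3) (j≤2h j<n))) (s≤s (σ-bounded h (i' % 3) (j≤2h j'<n)))
                         (proj₁ high)
    j≡j' : j ≡ j'
    j≡j' = σ-injective h (i % 3) (j≤2h j<n) (j≤2h j'<n)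
             (trans (proj₁ low) (cong (λ r → σ h r j') (sym (proj₂ low))))
    i/3≡i'/3 : i / 3 ≡ i' / 3
    i/3≡i'/3 = σ-injective g (j % 3) (i/3≤2g i<m) (i/3≤2g i'<m)
                 (trans (proj₂ high) (cong (λ j → σ g (j % 3) (i' / 3)) (sym j≡j')))
    i≡i' : i ≡ i'
    i≡i' = trans (m≡m%n+[m/n]*n i 3)
             (trans (cong₂ (λ r q → r + q * 3) (proj₂ low) i/3≡i'/3) (sym (m≡m%n+[m/n]*n i' 3)))

  φ≡cell : ∀ {a b} → a < m → b < n → φ a b ≡ cell a b
  φ≡cell a<m b<n = cong₂ cell (m<n⇒m%n≡m a<m) (m<n⇒m%n≡m b<n)

  lowPart-window : ∀ a b → window lowPart a b ≡ rowSum + rowSum + rowSum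
  lowPart-window a b = trans (sum₃-comm lowPart a b) (sum₃-cong column b)
    where
    open ≡-Reasoning
    column : ∀ j → sum₃ (λ i → lowPart i j) a ≡ rowSum
    column j = begin
      sum₃ (λ i → σ h (i % m % 3) y + i % m % 3 * n) a
        ≡⟨ sum₃-cong (λ i → cong (λ r → σ h r y + r * n) (m∣n⇒o%n%m≡o%m 3 m i 3∣m)) a ⟩
      sum₃ (λ i → σ h (i % 3) y + i % 3 * n) a
        ≡⟨ sum₃-mod-3 (λ r → σ h r y + r * n) a ⟩
      σ h 0 y + 0 * n + (σ h 1 y + 1 * n) + (σ h 2 y + 2 * n)
        ≡⟨ regroup (σ h 0 y) (σ h 1 y) (σ h 2 y) n ⟩
      σ h 0 y + σ h 1 y + σ h 2 y + 3 * n
        ≡⟨ cong (_+ 3 * n) (σ-sum h y (j≤2h (m%n<n j n))) ⟩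
      rowSum ∎
      where
      y = j % n
      regroup : ∀ a b c n → a + 0 * n + (b + 1 * n) + (c + 2 * n) ≡ a + b + c + 3 * n
      regroup = solve-∀

  highPart-window : 3 ∣ n ⊎ g ≡ 0 → ∀ a b → window highPart a b ≡ colSum + colSum + colSum
  highPart-window 3∣n⊎g≡0 a b = sum₃-cong row a
    where
    row : ∀ i → sum₃ (highPart i) b ≡ colSum
    row i = trans (sum₃-* (3 * n) (λ j → σ g (j % n % 3) (i % m / 3)) b)
                  (cong (_* (3 * n)) (σ-column-sum g n 3∣n⊎g≡0 (i/3≤2g (m%n<n i m)) b))

  labelling : 3 ∣ n ⊎ g ≡ 0 → MagicTorusLabelling m n φ K
  labelling 3∣n⊎g≡0 = record
    { periodic₁       = λ b x → cong (λ i → cell i (b % n)) ([n+m]%n≡m%n m x)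
    ; periodic₂       = λ a x → cong (cell (a % m)) ([n+m]%n≡m%n n x)
    ; bounded         = λ a b → cell-bounded (m%n<n a m) (m%n<n b n)
    ; injective       = λ a<m b<n a'<m b'<n e →
        cell-injective a<m b<n a'<m b'<n (trans (sym (φ≡cell a<m b<n)) (trans e (φ≡cell a'<m b'<n)))
    ; window-constant = λ a b →
        trans (window-+ lowPart highPart a b) (cong₂ _+_ (lowPart-window a b) (highPart-window 3∣n⊎g≡0 a b))
    }

labelling-3×odd : ∀ {x} → x % 2 ≡ 1 → ∃₂ λ φ k → MagicTorusLabelling 3 x φ k
labelling-3×odd {x} x%2≡1 =
  φ , K , subst (λ n → MagicTorusLabelling 3 n φ K) (sym (m%n≡r⇒m≡r+[m/n]*n x%2≡1)) (labelling (inj₂ refl))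
  where open Construction 0 (x / 2) using (φ; K; labelling)

magicSizes⇒labelling : ∀ {m n} → MagicSizes m n → ∃₂ λ φ k → MagicTorusLabelling m n φ k
magicSizes⇒labelling {m} {n} (inj₁ (m%6≡3 , n%6≡3)) =
  φ , K , subst₂ (λ m n → MagicTorusLabelling m n φ K) (sym m≡) (sym n≡) (labelling (inj₁ 3∣n))
  where
  g = m / 6
  q = n / 6
  open Construction g (1 + q * 3) using (φ; K; labelling)
  m≡ : m ≡ suc (g * 2) * 3
  m≡ = trans (m%n≡r⇒m≡r+[m/n]*n m%6≡3) (expand g)
    where
    expand : ∀ g → 3 + g * 6 ≡ suc (g * 2) * 3
    expand = solve-∀
  n≡ : n ≡ suc ((1 + q * 3) * 2)
  n≡ = trans (m%n≡r⇒m≡r+[m/n]*n n%6≡3) (expand q)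
    where
    expand : ∀ q → 3 + q * 6 ≡ suc ((1 + q * 3) * 2)
    expand = solve-∀
  3∣n : 3 ∣ suc ((1 + q * 3) * 2)
  3∣n = divides (1 + q * 2) (factor q)
    where
    factor : ∀ q → suc ((1 + q * 3) * 2) ≡ (1 + q * 2) * 3
    factor = solve-∀
magicSizes⇒labelling (inj₂ (x , x%2≡1 , inj₁ (refl , refl))) = labelling-3×odd x%2≡1
magicSizes⇒labelling (inj₂ (x , x%2≡1 , inj₂ (refl , refl))) =
  let _ , _ , L = labelling-3×odd x%2≡1 in _ , _ , transpose L

mainTheorem1 : (m n : ℕ) → m ≥ 3 → n ≥ 3 →
    (ClosedDistanceMagic (Cycle m ⊠ Cycle n) ⇔
      ((m % 6 ≡ 3 × n % 6 ≡ 3) ⊎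
       (Σ ℕ λ x → x % 2 ≡ 1 × ((m ≡ 3 × n ≡ x) ⊎ (m ≡ x × n ≡ 3)))))
mainTheorem1 _ _ m≥3@(s≤s (s≤s (s≤s _))) n≥3@(s≤s (s≤s (s≤s _))) = mk⇔
  (λ magic → let _ , _ , L = closedDistanceMagic⇒labelling magic in labelling⇒magicSizes m≥3 n≥3 L)
  (λ sizes → let _ , _ , L = magicSizes⇒labelling sizes in labelling⇒closedDistanceMagic L)
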